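{- Let $\mu$ be a multiplicity on $\mathcal{A}$ and $\theta_1,\dots,\theta_\ell\in\mathrm{Der}_S$. Then the following are equivalent: (1) $\{\theta_1,\dots,\theta_\ell\}$ is a basis for $D(\mathcal{A},\mu)$; (2) $\{\phi_q(\theta_1),\dots,\phi_q(\theta_\ell)\}$ is a basis for $D(\mathcal{A},q\mu)$.
   Context: Let $q=p^d$ be a prime power, $S=\mathbb{F}_q[x_1,\dots,x_\ell]$ and $\mathrm{Der}_S=\bigoplus_{i=1}^\ell S\partial_{x_i}$. Let $\mathcal{A}$ be a finite set of linear hyperplanes in $\mathbb{F}_q^\ell$; for $H\in\mathcal{A}$ fix a linear form $\alpha_H$ with coefficients in $\mathbb{F}_q$ and $H=\ker\alpha_H$. A multiplicity is a map $\mu:\mathcal{A}\to\mathbb{Z}_{\ge0}$, and $D(\mathcal{A},\mu)=\{\theta\in\mathrm{Der}_S:\theta(\alpha_H)\in\alpha_H^{\mu(H)}S\ \text{for all } H\in\mathcal{A}\}$; $q\mu$ is the multiplicity $H\mapsto q\mu(H)$. $\phi_q:S\to S$ is the Frobenius map $f\mapsto f^q$, extended to $\mathrm{Der}_S$ by $\phi_q(\sum_i f_i\partial_{x_i})=\sum_i\phi_q(f_i)\partial_{x_i}$. -}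

module Defs where

open import Level using (Level; _⊔_)
open import Algebra.Bundles using (CommutativeRing)
open import Data.Nat using (ℕ; zero; suc)
open import Data.Fin using (Fin; zero; suc)
open import Data.List using (List; []; _∷_; map)
open import Data.Product using (Σ; _×_; ∃; _,_)
open import Data.Unit.Polymorphic using (⊤)
open import Relation.Nullary using (¬_)
open import Relation.Binary.PropositionalEquality using (_≡_)

module Over {c ℓr : Level} (R : CommutativeRing c ℓr) where
  open CommutativeRing R using (_≈_; _+_; _*_; 0#; 1#) renaming (Carrier to F)

  record IsField : Set (c ⊔ ℓr) where
    field
      1≉0     : ¬ (1# ≈ 0#)
      inverse : ∀ x → ¬ (x ≈ 0#) → Σ F λ y → (x * y) ≈ 1#

  record HasCard (q : ℕ) : Set (c ⊔ ℓr) where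
    field
      enum      : Fin q → F
      enum-surj : ∀ x → Σ (Fin q) λ i → enum i ≈ x
      enum-inj  : ∀ i j → enum i ≈ enum j → i ≡ j

  -- Polynomial ring S_n = F[x_1,...,x_n], recursively:
  -- S_0 = F, S_(n+1) = S_n[t] as coefficient lists (lowest degree first).
  Poly : ℕ → Set c
  Poly zero    = F
  Poly (suc n) = List (Poly n)

  zeroP : ∀ n → Poly n
  zeroP zero    = 0#
  zeroP (suc n) = []

  constP : ∀ n → F → Poly n
  constP zero    a = a
  constP (suc n) a = constP n a ∷ []

  oneP : ∀ n → Poly n
  oneP n = constP n 1#

  -- equality of coefficient lists up to trailing zeros
  eqL : ∀ {a b} {A : Set a} → (A → A → Set b) → A → List A → List A → Set b
  eqL E z []       []       = ⊤
  eqL E z []       (y ∷ ys) = E z y × eqL E z [] ys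
  eqL E z (x ∷ xs) []       = E x z × eqL E z xs []
  eqL E z (x ∷ xs) (y ∷ ys) = E x y × eqL E z xs ys

  eqP : ∀ n → Poly n → Poly n → Set ℓr
  eqP zero    = _≈_
  eqP (suc n) = eqL (eqP n) (zeroP n)

  addL : ∀ {a} {A : Set a} → (A → A → A) → List A → List A → List A
  addL f []       ys       = ys
  addL f (x ∷ xs) []       = x ∷ xs
  addL f (x ∷ xs) (y ∷ ys) = f x y ∷ addL f xs ys

  addP : ∀ n → Poly n → Poly n → Poly n
  addP zero    = _+_
  addP (suc n) = addL (addP n)

  mulL : ∀ {a} {A : Set a} → A → (A → A → A) → (A → A → A) →
         List A → List A → List A
  mulL z ad mu []       ys = []
  mulL z ad mu (x ∷ xs) ys =
    addL ad (map (mu x) ys) (z ∷ mulL z ad mu xs ys)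

  mulP : ∀ n → Poly n → Poly n → Poly n
  mulP zero    = _*_
  mulP (suc n) = mulL (zeroP n) (addP n) (mulP n)

  powP : ∀ n → Poly n → ℕ → Poly n
  powP n f zero    = oneP n
  powP n f (suc k) = mulP n f (powP n f k)

  -- the variables x_1, ..., x_n (x at index zero is the outermost variable)
  var : ∀ n → Fin n → Poly n
  var (suc n) zero    = zeroP n ∷ oneP n ∷ []
  var (suc n) (suc i) = var n i ∷ []

  sumP : ∀ n k → (Fin k → Poly n) → Poly n
  sumP n zero    f = zeroP n
  sumP n (suc k) f = addP n (f zero) (sumP n k (λ i → f (suc i)))

  LinForm : ℕ → Set c
  LinForm l = Fin l → F

  linP : ∀ {l} → LinForm l → Poly l
  linP {l} α = sumP l l (λ i → mulP l (constP l (α i)) (var l i))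

  -- Der_S = ⊕ S ∂_{x_i}: θ = Σ θ_i ∂_{x_i} is the vector (θ_i)
  Der : ℕ → Set c
  Der l = Fin l → Poly l

  -- θ(α) for a linear form α = Σ a_i x_i : Σ a_i θ_i
  applyLin : ∀ {l} → Der l → LinForm l → Poly l
  applyLin {l} θ α = sumP l l (λ i → mulP l (constP l (α i)) (θ i))

  frob : ∀ n → ℕ → Poly n → Poly n
  frob n q f = powP n f q

  frobDer : ∀ {l} → ℕ → Der l → Der l
  frobDer {l} q θ i = frob l q (θ i)

  -- Hyperplane arrangements: m hyperplanes H_j = ker α_j.
  -- Each α_j is nonzero (so ker α_j is a hyperplane) and distinct indices
  -- give distinct hyperplanes (α_j not a scalar multiple of α_k).
  record IsArrangement {l m : ℕ} (α : Fin m → LinForm l) : Set (c ⊔ ℓr) where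
    field
      nonzero  : ∀ j → Σ (Fin l) λ i → ¬ (α j i ≈ 0#)
      distinct : ∀ j k → ¬ (j ≡ k) → ¬ (Σ F λ a → ∀ i → α j i ≈ (a * α k i))

  Multiplicity : ℕ → Set
  Multiplicity m = Fin m → ℕ

  InIdeal : ∀ n → Poly n → Poly n → Set (c ⊔ ℓr)
  InIdeal n f g = Σ (Poly n) λ h → eqP n f (mulP n g h)

  InD : ∀ {l m} → (Fin m → LinForm l) → Multiplicity m → Der l → Set (c ⊔ ℓr)
  InD {l} α μ θ = ∀ j → InIdeal l (applyLin θ (α j)) (powP l (linP (α j)) (μ j))

  combo : ∀ {l} → (Fin l → Poly l) → (Fin l → Der l) → Der l
  combo {l} f θ i = sumP l l (λ j → mulP l (f j) (θ j i))

  record IsBasis {l m : ℕ} (α : Fin m → LinForm l) (μ : Multiplicity m)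
                 (θ : Fin l → Der l) : Set (c ⊔ ℓr) where
    field
      members     : ∀ j → InD α μ (θ j)
      spanning    : ∀ η → InD α μ η →
                    Σ (Fin l → Poly l) λ f → ∀ i → eqP l (η i) (combo f θ i)
      independent : ∀ f → (∀ i → eqP l (combo f θ i) (zeroP l)) →
                    ∀ j → eqP l (f j) (zeroP l)

  scaleMult : ∀ {m} → ℕ → Multiplicity m → Multiplicity m
  scaleMult q μ j = q Data.Nat.* μ j

{-# OPTIONS --safe #-}
module Submission where

-- Over F_q the Frobenius φ(f) = f ^ q is a ring endomorphism of S = F_q[x_1, …, x_l] fixing F_q
-- (x ^ q = x on F_q, and q is a power of the characteristic), and S is a free φ(S)-module on the
-- monomials x^e with 0 ≤ e_i < q: f = Σ_e x^e φ(π_e f). The coordinate maps π_e are additive and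
-- semilinear, π_e (φ(h) f) = h π_e f, and π_0 ∘ φ = id. Since α_H has coefficients in F_q we get
-- (φθ)(α_H) = φ(θ(α_H)) and φ(α_H ^ μ) = α_H ^ (qμ), so φ maps D(A, μ) into D(A, qμ) and every π_e maps
-- D(A, qμ) into D(A, μ). A basis θ of D(A, μ) then yields the basis φθ of D(A, qμ) by working one
-- coordinate π_e at a time, and conversely a basis φθ yields θ by applying π_0 after φ.

open import Defs
open import Level using (Level; _⊔_)
open import Algebra.Bundles using (CommutativeRing; CommutativeSemiring; CommutativeMonoid; Monoid)
open import Algebra.Structures using (IsCommutativeMonoid; IsCommutativeSemiring)
open import Algebra.Structures.Biased using (isCommutativeSemiringˡ)
import Algebra.Properties.CommutativeSemigroup as CommutativeSemigroupProperties
import Algebra.Properties.CommutativeMonoid.Sum as CommutativeMonoidSum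
open import Data.Nat using (ℕ)
open import Data.Nat as ℕ using (zero; suc; NonZero; _∸_; _<_; _≤_; z≤n; s≤s; _!)
open import Data.Nat.Properties as ℕ using ()
open import Data.Nat.Divisibility using (_∣_; _∤_; divides; ∣⇒≤; ∣1⇒≡1; m∣m*n; n∣m*n)
open import Data.Nat.DivMod using (_/_; _%_; _mod_; _divMod_; result)
open import Data.Nat.DivMod using (m/n*n≡m; m*n/n≡m; m<n⇒m/n≡0; m<n⇒m%n≡m; [m+kn]%n≡m%n; +-distrib-/-∣ˡ)
open import Data.Nat.Primality using (Prime; euclidsLemma; prime⇒nonZero; ¬prime[1])
open import Data.Nat.Combinatorics using (_C_; nCn≡1; k![n∸k]!∣n!)
open import Data.Nat.Combinatorics.Specification using (nCk≡n!/k![n-k]!)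
open import Data.Fin as Fin using (Fin; zero; suc; toℕ; inject₁; punchIn)
open import Data.Fin.Permutation using (Permutation; permutation)
open import Data.Fin.Properties using (toℕ-fromℕ; toℕ-fromℕ<; inject₁ℕ<; toℕ<n; toℕ-injective)
open import Data.Fin.Properties using (punchInᵢ≢i)
open import Data.List using (List; []; _∷_; _++_; map; length; replicate; applyUpTo)
open import Data.List.Properties using (length-applyUpTo)
open import Data.Product using (Σ; proj₁; proj₂; _,_)
open import Data.Sum using (inj₁; inj₂)
open import Data.Unit.Polymorphic using (tt)
open import Data.Vec as Vec using (Vec; []; _∷_)
import Data.Vec.Functional as Vector
open import Function using (_∘_; Inverse; Func)
open import Function.Bundles using (_⇔_; mk⇔)
import Function.Consequences.Setoid as FunctionConsequences
open import Relation.Binary.Bundles using (Setoid)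
open import Relation.Binary.Definitions using (Decidable)
open import Relation.Binary.Structures using (IsEquivalence)
open import Relation.Nullary using (¬_; yes; no; contradiction)
open import Relation.Nullary.Decidable using (map′)
open import Relation.Binary.PropositionalEquality as ≡ using (_≡_)

p∤m! : ∀ {p m} → Prime p → m < p → p ∤ m !
p∤m! {m = zero}  p-prime _   p∣1  = ¬prime[1] (≡.subst Prime (∣1⇒≡1 p∣1) p-prime)
p∤m! {m = suc m} p-prime m<p p∣m! with euclidsLemma (suc m) (m !) p-prime p∣m!
... | inj₁ p∣1+m = ℕ.<⇒≱ m<p (∣⇒≤ p∣1+m)
... | inj₂ p∣m!′ = p∤m! p-prime (ℕ.<-trans (ℕ.n<1+n m) m<p) p∣m!′

n∣n! : ∀ n .{{_ : NonZero n}} → n ∣ n !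
n∣n! (suc n) = m∣m*n (n !)

nCk*k!*[n∸k]!≡n! : ∀ {n k} → k ≤ n → (n C k) ℕ.* (k ! ℕ.* (n ∸ k) !) ≡ n !
nCk*k!*[n∸k]!≡n! {n} {k} k≤n =
  ≡.trans (≡.cong (ℕ._* (k ! ℕ.* (n ∸ k) !)) (nCk≡n!/k![n-k]! k≤n)) (m/n*n≡m (k![n∸k]!∣n! k≤n))
  where instance _ = k ℕ.!* (n ∸ k) !≢0

p∣pCk : ∀ {p k} → Prime p → 0 < k → k < p → p ∣ p C k
p∣pCk {p} {k} p-prime 0<k k<p with euclidsLemma (p C k) (k ! ℕ.* (p ∸ k) !) p-prime p∣p!
  where
  p∣p! : p ∣ (p C k) ℕ.* (k ! ℕ.* (p ∸ k) !)
  p∣p! = ≡.subst (p ∣_) (≡.sym (nCk*k!*[n∸k]!≡n! (ℕ.<⇒≤ k<p)))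
                 (n∣n! p {{prime⇒nonZero p-prime}})
... | inj₁ p∣C = p∣C
... | inj₂ p∣k!*[p∸k]! with euclidsLemma (k !) ((p ∸ k) !) p-prime p∣k!*[p∸k]!
...   | inj₁ p∣k!     = contradiction p∣k! (p∤m! p-prime k<p)
...   | inj₂ p∣[p∸k]! = contradiction p∣[p∸k]! (p∤m! p-prime (ℕ.∸-monoʳ-< 0<k (ℕ.<⇒≤ k<p)))

Bounded : {A : Set} → (A → ℕ) → Set
Bounded {A} g = Σ ℕ λ B → ∀ a → g a ≤ B

bounded-Fin : ∀ {k} (g : Fin k → ℕ) → Bounded g
bounded-Fin {zero}  g = 0 , λ ()
bounded-Fin {suc k} g = g zero ℕ.⊔ proj₁ rest , λ where
    zero    → ℕ.m≤m⊔n _ _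
    (suc i) → ℕ.m≤n⇒m≤o⊔n (g zero) (proj₂ rest i)
  where
  rest : Bounded (g ∘ suc)
  rest = bounded-Fin (g ∘ suc)

bounded-Vec : ∀ {k} n (g : Vec (Fin k) n → ℕ) → Bounded g
bounded-Vec zero    g = g [] , λ where [] → ℕ.≤-refl
bounded-Vec (suc n) g = proj₁ overHeads , λ where
    (r ∷ m) → ℕ.≤-trans (proj₂ (bounded-Vec n (g ∘ (r ∷_))) m) (proj₂ overHeads r)
  where
  overHeads : Bounded (λ r → proj₁ (bounded-Vec n (g ∘ (r ∷_))))
  overHeads = bounded-Fin _

module PrimeCharacteristic {a ℓ : Level} (S : CommutativeSemiring a ℓ) where
  open CommutativeSemiring S hiding (zero)
  open import Algebra.Properties.CommutativeSemiring.Binomial S using (theorem; binomial; binomialTerm)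
  open import Algebra.Properties.Semiring.Mult semiring using (_×_; ×-congʳ; ×-assoc-*; ×1-homo-*)
  open import Algebra.Properties.Semiring.Exp semiring using (_^_; ^-assocʳ; ^-congˡ)
  open import Algebra.Properties.Semiring.Sum semiring using (sum; sum-init-last; sum-cong-≋; sum-replicate-zero)
  open Vector using (init; last)
  open import Relation.Binary.Reasoning.Setoid setoid

  ∣⇒×≈0 : ∀ {m n} → n × 1# ≈ 0# → n ∣ m → ∀ x → m × x ≈ 0#
  ∣⇒×≈0 {n = n} n×1≈0 (divides t ≡.refl) x = begin
    (t ℕ.* n) × x               ≈⟨ ×-congʳ (t ℕ.* n) (sym (*-identityˡ x)) ⟩
    (t ℕ.* n) × (1# * x)        ≈⟨ ×-assoc-* (t ℕ.* n) 1# x ⟨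
    (t ℕ.* n) × 1# * x          ≈⟨ *-congʳ (×1-homo-* t n) ⟩
    (t × 1#) * (n × 1#) * x     ≈⟨ *-congʳ (*-congˡ n×1≈0) ⟩
    (t × 1#) * 0# * x           ≈⟨ *-congʳ (zeroʳ _) ⟩
    0# * x                      ≈⟨ zeroˡ x ⟩
    0#                          ∎

  ^p-distrib-+ : ∀ {p} → Prime p → p × 1# ≈ 0# → ∀ x y → (x + y) ^ p ≈ x ^ p + y ^ p
  ^p-distrib-+ {p@(suc (suc n))} p-prime char x y = begin
    (x + y) ^ p                                       ≈⟨ theorem p x y ⟩
    t zero + sum (t ∘ suc)                            ≈⟨ +-congˡ (sum-init-last (t ∘ suc)) ⟩
    t zero + (sum (init (t ∘ suc)) + last (t ∘ suc))  ≈⟨ +-cong first≈y^p (+-cong middle≈0 last≈x^p) ⟩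
    y ^ p + (0# + x ^ p)                              ≈⟨ +-comm _ _ ⟩
    0# + x ^ p + y ^ p                                ≈⟨ +-congʳ (+-identityˡ _) ⟩
    x ^ p + y ^ p                                     ∎
    where
    t : Fin (suc p) → Carrier
    t = binomialTerm x y p

    first≈y^p : t zero ≈ y ^ p
    first≈y^p = trans (+-identityʳ _) (*-identityˡ _)

    middle≈0 : sum (init (t ∘ suc)) ≈ 0#
    middle≈0 = trans (sum-cong-≋ λ i → ∣⇒×≈0 char (p∣pCk p-prime (s≤s z≤n) (s≤s (inject₁ℕ< i)))
                                                (binomial x y p (suc (inject₁ i))))
                     (sum-replicate-zero (suc n))

    last≈x^p : last (t ∘ suc) ≈ x ^ p
    last≈x^p = t-top (≡.cong suc (toℕ-fromℕ (suc n)))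
      where
      t-top : ∀ {k} → k ≡ p → (p C k) × (x ^ k * y ^ (p ∸ k)) ≈ x ^ p
      t-top ≡.refl rewrite nCn≡1 p | ℕ.n∸n≡0 p = trans (+-identityʳ _) (*-identityʳ _)

  ^[p^d]-distrib-+ : ∀ {p} → Prime p → p × 1# ≈ 0# → ∀ d x y →
                     (x + y) ^ (p ℕ.^ d) ≈ x ^ (p ℕ.^ d) + y ^ (p ℕ.^ d)
  ^[p^d]-distrib-+ p-prime char zero x y = trans (*-identityʳ _) (sym (+-cong (*-identityʳ x) (*-identityʳ y)))
  ^[p^d]-distrib-+ {p} p-prime char (suc d) x y = begin
    (x + y) ^ (p ℕ.* q)              ≈⟨ ^-assocʳ (x + y) p q ⟨
    ((x + y) ^ p) ^ q                ≈⟨ ^-congˡ q (^p-distrib-+ p-prime char x y) ⟩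
    (x ^ p + y ^ p) ^ q              ≈⟨ ^[p^d]-distrib-+ p-prime char d (x ^ p) (y ^ p) ⟩
    (x ^ p) ^ q + (y ^ p) ^ q        ≈⟨ +-cong (^-assocʳ x p q) (^-assocʳ y p q) ⟩
    x ^ (p ℕ.* q) + y ^ (p ℕ.* q)    ∎
    where
    q : ℕ
    q = p ℕ.^ d

module _ {a ℓ : Level} (M : Monoid a ℓ) where
  open Monoid M

  unitTranslation : ∀ x y → x ∙ y ≈ ε → y ∙ x ≈ ε → Inverse setoid setoid
  unitTranslation x y xy≈ε yx≈ε = record
    { to        = x ∙_
    ; from      = y ∙_
    ; to-cong   = ∙-congˡ
    ; from-cong = ∙-congˡ
    ; inverse   = strictlyInverseˡ⇒inverseˡ ∙-congˡ (cancel xy≈ε)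
                , strictlyInverseʳ⇒inverseʳ ∙-congˡ (cancel yx≈ε)
    }
    where
    open FunctionConsequences setoid setoid using (strictlyInverseˡ⇒inverseˡ; strictlyInverseʳ⇒inverseʳ)
    cancel : ∀ {u v} → u ∙ v ≈ ε → ∀ z → u ∙ (v ∙ z) ≈ z
    cancel uv≈ε z = trans (sym (assoc _ _ z)) (trans (∙-congʳ uv≈ε) (identityˡ z))

module FieldProperties {c ℓr : Level} (R : CommutativeRing c ℓr) (isField : Over.IsField R) where
  open CommutativeRing R hiding (zero) renaming (Carrier to F)
  open Over R using (powP)
  open Over.IsField isField
  open import Relation.Binary.Reasoning.Setoid setoid
  private module Π* = CommutativeMonoidSum *-commutativeMonoid

  ∏ : ∀ {n} → (Fin n → F) → F
  ∏ = Π*.sum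

  *-nonzero : ∀ {x y} → ¬ x ≈ 0# → ¬ y ≈ 0# → ¬ x * y ≈ 0#
  *-nonzero {x} {y} x≉0 y≉0 xy≈0 = y≉0 (begin
    y              ≈⟨ *-identityˡ y ⟨
    1# * y         ≈⟨ *-congʳ (trans (*-comm x⁻¹ x) (proj₂ (inverse x x≉0))) ⟨
    x⁻¹ * x * y    ≈⟨ *-assoc x⁻¹ x y ⟩
    x⁻¹ * (x * y)  ≈⟨ *-congˡ xy≈0 ⟩
    x⁻¹ * 0#       ≈⟨ zeroʳ x⁻¹ ⟩
    0#             ∎)
    where
    x⁻¹ : F
    x⁻¹ = proj₁ (inverse x x≉0)

  *≈ʳ⇒≈1 : ∀ {x z} → ¬ z ≈ 0# → x * z ≈ z → x ≈ 1#
  *≈ʳ⇒≈1 {x} {z} z≉0 xz≈z = begin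
    x               ≈⟨ *-identityʳ x ⟨
    x * 1#          ≈⟨ *-congˡ (proj₂ (inverse z z≉0)) ⟨
    x * (z * z⁻¹)   ≈⟨ *-assoc x z z⁻¹ ⟨
    x * z * z⁻¹     ≈⟨ *-congʳ xz≈z ⟩
    z * z⁻¹         ≈⟨ proj₂ (inverse z z≉0) ⟩
    1#              ∎
    where
    z⁻¹ : F
    z⁻¹ = proj₁ (inverse z z≉0)

  powP-nonzero : ∀ {x} k → ¬ x ≈ 0# → ¬ powP zero x k ≈ 0#
  powP-nonzero zero    x≉0 = 1≉0
  powP-nonzero (suc k) x≉0 = *-nonzero x≉0 (powP-nonzero k x≉0)

  ∏-nonzero : ∀ {n} (f : Fin n → F) → (∀ i → ¬ f i ≈ 0#) → ¬ ∏ f ≈ 0#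
  ∏-nonzero {zero}  f f≉0 = 1≉0
  ∏-nonzero {suc n} f f≉0 = *-nonzero (f≉0 Fin.zero) (∏-nonzero (f ∘ Fin.suc) (f≉0 ∘ Fin.suc))

  ∏-replicate : ∀ n a → ∏ (Vector.replicate n a) ≈ powP zero a n
  ∏-replicate zero    a = refl
  ∏-replicate (suc n) a = *-congˡ (∏-replicate n a)

module FiniteField {c ℓr : Level} (R : CommutativeRing c ℓr) (isField : Over.IsField R)
                   {q′ : ℕ} (card : Over.HasCard R (suc q′)) where
  open CommutativeRing R hiding (zero) renaming (Carrier to F)
  open Over R using (powP)
  open Over.IsField isField
  open Over.HasCard card
  open FieldProperties R isField
  open import Relation.Binary.Reasoning.Setoid setoid

  q : ℕ
  q = suc q′

  index : F → Fin q
  index x = proj₁ (enum-surj x)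

  enum-index : ∀ x → enum (index x) ≈ x
  enum-index x = proj₂ (enum-surj x)

  index-cong : ∀ {x y} → x ≈ y → index x ≡ index y
  index-cong {x} {y} x≈y = enum-inj _ _ (trans (enum-index x) (trans x≈y (sym (enum-index y))))

  index-enum : ∀ i → index (enum i) ≡ i
  index-enum i = enum-inj _ _ (enum-index (enum i))

  _≟_ : Decidable _≈_
  x ≟ y = map′ (λ i≡j → trans (sym (enum-index x)) (trans (reflexive (≡.cong enum i≡j)) (enum-index y)))
               index-cong (index x Fin.≟ index y)

  module _ {m ℓm : Level} (M : CommutativeMonoid m ℓm) where
    private module M = CommutativeMonoid M
    open CommutativeMonoidSum M using (sum; sum-permute; sum-cong-≋)

    sum-reindex : (g : Func setoid M.setoid) (T : Inverse setoid setoid) →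
                  sum (Func.to g ∘ enum) M.≈ sum (Func.to g ∘ Inverse.to T ∘ enum)
    sum-reindex g T = M.trans (sum-permute (Func.to g ∘ enum) π)
                              (sum-cong-≋ λ i → Func.cong g (enum-index (T.to (enum i))))
      where
      module T = Inverse T
      reindex : (F → F) → Fin q → Fin q
      reindex f i = index (f (enum i))
      reindex-inverse : ∀ {f g} → (∀ {x y} → x ≈ y → f x ≈ f y) → (∀ x → f (g x) ≈ x) →
                        ∀ i → reindex f (reindex g i) ≡ i
      reindex-inverse f-cong fg≈id i =
        ≡.trans (index-cong (trans (f-cong (enum-index _)) (fg≈id (enum i)))) (index-enum i)
      π : Permutation q q
      π = permutation (reindex T.to) (reindex T.from)
            (reindex-inverse T.to-cong T.strictlyInverseˡ) (reindex-inverse T.from-cong T.strictlyInverseʳ)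

  open import Algebra.Properties.Semiring.Mult semiring using (_×_; ×1-homo-*)
  private
    module Σ+ = CommutativeMonoidSum +-commutativeMonoid
    module Π* = CommutativeMonoidSum *-commutativeMonoid

  q×x≈0 : ∀ x → q × x ≈ 0#
  q×x≈0 x = ∙-cancelʳ (Σ+.sum enum) _ _ (begin
    q × x + Σ+.sum enum                          ≈⟨ +-congʳ (Σ+.sum-replicate q) ⟨
    Σ+.sum (Vector.replicate q x) + Σ+.sum enum  ≈⟨ Σ+.∑-distrib-+ (Vector.replicate q x) enum ⟨
    Σ+.sum ((x +_) ∘ enum)                       ≈⟨ sum-reindex +-commutativeMonoid (function setoid) x+_ ⟨
    Σ+.sum enum                                  ≈⟨ +-identityˡ _ ⟨
    0# + Σ+.sum enum                             ∎)
    where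
    open import Algebra.Properties.Group +-group using (∙-cancelʳ)
    open import Function.Construct.Identity using (function)
    x+_ : Inverse setoid setoid
    x+_ = unitTranslation +-monoid x (- x) (-‿inverseʳ x) (-‿inverseˡ x)

  zeroToOne : F → F
  zeroToOne x with x ≟ 0#
  ... | yes _ = 1#
  ... | no  _ = x

  zeroToOne-≈0 : ∀ {x} → x ≈ 0# → zeroToOne x ≈ 1#
  zeroToOne-≈0 {x} x≈0 with x ≟ 0#
  ... | yes _   = refl
  ... | no  x≉0 = contradiction x≈0 x≉0

  zeroToOne-≉0 : ∀ {x} → ¬ x ≈ 0# → zeroToOne x ≈ x
  zeroToOne-≉0 {x} x≉0 with x ≟ 0#
  ... | yes x≈0 = contradiction x≈0 x≉0
  ... | no  _   = refl

  zeroToOne-cong : ∀ {x y} → x ≈ y → zeroToOne x ≈ zeroToOne y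
  zeroToOne-cong {x} {y} x≈y with y ≟ 0#
  ... | yes y≈0 = zeroToOne-≈0 (trans x≈y y≈0)
  ... | no  y≉0 = trans (zeroToOne-≉0 (y≉0 ∘ trans (sym x≈y))) x≈y

  ∏-zeroToOne : ∀ {n} (f : Fin (suc n) → F) i → f i ≈ 0# → (∀ j → ¬ f (punchIn i j) ≈ 0#) →
                ∏ (zeroToOne ∘ f) ≈ ∏ (f ∘ punchIn i)
  ∏-zeroToOne f i fi≈0 f≉0 = begin
    ∏ (zeroToOne ∘ f)                                ≈⟨ Π*.sum-remove {i = i} (zeroToOne ∘ f) ⟩
    zeroToOne (f i) * ∏ (zeroToOne ∘ f ∘ punchIn i)  ≈⟨ *-cong (zeroToOne-≈0 fi≈0)
                                                                (Π*.sum-cong-≋ (zeroToOne-≉0 ∘ f≉0)) ⟩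
    1# * ∏ (f ∘ punchIn i)                           ≈⟨ *-identityˡ _ ⟩
    ∏ (f ∘ punchIn i)                                ∎

  -- Multiplication by x ≉ 0 permutes F, and zeroToOne turns the product over F into the product P
  -- of the nonzero elements both before and after permuting; hence x ^ (q - 1) * P ≈ P.
  x^q≈x : ∀ x → powP zero x q ≈ x
  x^q≈x x with x ≟ 0#
  ... | yes x≈0 = trans (*-congʳ x≈0) (trans (zeroˡ _) (sym x≈0))
  ... | no  x≉0 = begin
    x * powP zero x q′  ≈⟨ *-congˡ (*≈ʳ⇒≈1 (∏-nonzero _ nonzero) x^q′*P≈P) ⟩
    x * 1#              ≈⟨ *-identityʳ x ⟩
    x                   ∎
    where
    i₀ : Fin q
    i₀ = index 0#
    nonzero : ∀ j → ¬ enum (punchIn i₀ j) ≈ 0#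
    nonzero j e = punchInᵢ≢i i₀ j (≡.trans (≡.sym (index-enum _)) (index-cong e))
    P : F
    P = ∏ (enum ∘ punchIn i₀)
    x⁻¹ : F
    x⁻¹ = proj₁ (inverse x x≉0)
    x*_ : Inverse setoid setoid
    x*_ = unitTranslation *-monoid x x⁻¹ xx⁻¹≈1 (trans (*-comm x⁻¹ x) xx⁻¹≈1)
      where
      xx⁻¹≈1 : x * x⁻¹ ≈ 1#
      xx⁻¹≈1 = proj₂ (inverse x x≉0)
    x*nonzero : ∀ j → ¬ x * enum (punchIn i₀ j) ≈ 0#
    x*nonzero = *-nonzero x≉0 ∘ nonzero
    x*0≈0 : x * enum i₀ ≈ 0#
    x*0≈0 = trans (*-congˡ (enum-index 0#)) (zeroʳ x)
    zeroToOne-func : Func setoid setoid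
    zeroToOne-func = record { to = zeroToOne ; cong = zeroToOne-cong }
    x^q′*P≈P : powP zero x q′ * P ≈ P
    x^q′*P≈P = begin
      powP zero x q′ * P                ≈⟨ *-congʳ (∏-replicate q′ x) ⟨
      ∏ (Vector.replicate q′ x) * P     ≈⟨ Π*.∑-distrib-+ (Vector.replicate q′ x) _ ⟨
      ∏ ((x *_) ∘ enum ∘ punchIn i₀)    ≈⟨ ∏-zeroToOne ((x *_) ∘ enum) i₀ x*0≈0 x*nonzero ⟨
      ∏ (zeroToOne ∘ (x *_) ∘ enum)     ≈⟨ sum-reindex *-commutativeMonoid zeroToOne-func x*_ ⟨
      ∏ (zeroToOne ∘ enum)              ≈⟨ ∏-zeroToOne enum i₀ (enum-index 0#) nonzero ⟩
      P                                 ∎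

  [p^d]×1≈powP : ∀ p d → (p ℕ.^ d) × 1# ≈ powP zero (p × 1#) d
  [p^d]×1≈powP p zero    = +-identityʳ 1#
  [p^d]×1≈powP p (suc d) = trans (×1-homo-* p (p ℕ.^ d)) (*-congˡ ([p^d]×1≈powP p d))

  p×1≈0 : ∀ {p d} → q ≡ p ℕ.^ d → p × 1# ≈ 0#
  p×1≈0 {p} {d} q≡p^d with (p × 1#) ≟ 0#
  ... | yes p×1≈0 = p×1≈0
  ... | no  p×1≉0 = contradiction [p×1]^d≈0 (powP-nonzero d p×1≉0)
    where
    [p×1]^d≈0 : powP zero (p × 1#) d ≈ 0#
    [p×1]^d≈0 = trans (sym ([p^d]×1≈powP p d)) (≡.subst (λ n → n × 1# ≈ 0#) q≡p^d (q×x≈0 1#))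

module _ {c ℓr : Level} (R : CommutativeRing c ℓr) where
  open Over R

  -- The list operations of Over R do not use R, so they serve for coefficients in any semiring A.
  module CoefficientList {a ℓ : Level} (A : CommutativeSemiring a ℓ) where
    open CommutativeSemiring A hiding (zero)

    infix  4 _≋_
    infixl 6 _⊕_
    infixl 7 _⊗_ _·_

    _≋_ : List Carrier → List Carrier → Set ℓ
    _≋_ = eqL _≈_ 0#

    _⊕_ : List Carrier → List Carrier → List Carrier
    _⊕_ = addL _+_

    _⊗_ : List Carrier → List Carrier → List Carrier
    _⊗_ = mulL 0# _+_ _*_

    _·_ : Carrier → List Carrier → List Carrier
    a · xs = map (a *_) xs

    shift : List Carrier → List Carrier
    shift xs = 0# ∷ xs

    coeff : List Carrier → ℕ → Carrier
    coeff []       _       = 0#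
    coeff (x ∷ xs) zero    = x
    coeff (x ∷ xs) (suc k) = coeff xs k

    coeff-cong : ∀ {xs ys} → xs ≋ ys → ∀ k → coeff xs k ≈ coeff ys k
    coeff-cong {[]}     {[]}     _       _       = refl
    coeff-cong {[]}     {y ∷ ys} (e , _) zero    = e
    coeff-cong {[]}     {y ∷ ys} (_ , r) (suc k) = coeff-cong {[]} {ys} r k
    coeff-cong {x ∷ xs} {[]}     (e , _) zero    = e
    coeff-cong {x ∷ xs} {[]}     (_ , r) (suc k) = coeff-cong {xs} {[]} r k
    coeff-cong {x ∷ xs} {y ∷ ys} (e , _) zero    = e
    coeff-cong {x ∷ xs} {y ∷ ys} (_ , r) (suc k) = coeff-cong {xs} {ys} r k

    coeff-ext : ∀ {xs ys} → (∀ k → coeff xs k ≈ coeff ys k) → xs ≋ ys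
    coeff-ext {[]}     {[]}     _ = tt
    coeff-ext {[]}     {y ∷ ys} h = h zero , coeff-ext {[]} {ys} (h ∘ suc)
    coeff-ext {x ∷ xs} {[]}     h = h zero , coeff-ext {xs} {[]} (h ∘ suc)
    coeff-ext {x ∷ xs} {y ∷ ys} h = h zero , coeff-ext {xs} {ys} (h ∘ suc)

    ≋-isEquivalence : IsEquivalence _≋_
    ≋-isEquivalence = record
      { refl  = λ {xs} → coeff-ext {xs} {xs} (λ _ → refl)
      ; sym   = λ {xs} {ys} p → coeff-ext {ys} {xs} (sym ∘ coeff-cong p)
      ; trans = λ {xs} {ys} {zs} p q → coeff-ext {xs} {zs} (λ k → trans (coeff-cong p k) (coeff-cong q k))
      }

    ≋-setoid : Setoid a ℓ
    ≋-setoid = record { isEquivalence = ≋-isEquivalence }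

    open IsEquivalence ≋-isEquivalence public
      using () renaming (refl to ≋-refl; sym to ≋-sym; trans to ≋-trans)

    coeff-⊕ : ∀ xs ys k → coeff (xs ⊕ ys) k ≈ coeff xs k + coeff ys k
    coeff-⊕ []       ys       k       = sym (+-identityˡ _)
    coeff-⊕ (x ∷ xs) []       k       = sym (+-identityʳ _)
    coeff-⊕ (x ∷ xs) (y ∷ ys) zero    = refl
    coeff-⊕ (x ∷ xs) (y ∷ ys) (suc k) = coeff-⊕ xs ys k

    coeff-· : ∀ a xs k → coeff (a · xs) k ≈ a * coeff xs k
    coeff-· a []       k       = sym (zeroʳ a)
    coeff-· a (x ∷ xs) zero    = refl
    coeff-· a (x ∷ xs) (suc k) = coeff-· a xs k

    ⊕-cong : ∀ {xs xs′ ys ys′} → xs ≋ xs′ → ys ≋ ys′ → xs ⊕ ys ≋ xs′ ⊕ ys′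
    ⊕-cong {xs} {xs′} {ys} {ys′} p q = coeff-ext λ k →
      trans (coeff-⊕ xs ys k) (trans (+-cong (coeff-cong p k) (coeff-cong q k)) (sym (coeff-⊕ xs′ ys′ k)))

    ⊕-assoc : ∀ xs ys zs → (xs ⊕ ys) ⊕ zs ≋ xs ⊕ (ys ⊕ zs)
    ⊕-assoc xs ys zs = coeff-ext λ k → begin
      coeff ((xs ⊕ ys) ⊕ zs) k                ≈⟨ trans (coeff-⊕ (xs ⊕ ys) zs k) (+-congʳ (coeff-⊕ xs ys k)) ⟩
      coeff xs k + coeff ys k + coeff zs k    ≈⟨ +-assoc _ _ _ ⟩
      coeff xs k + (coeff ys k + coeff zs k)  ≈⟨ trans (coeff-⊕ xs (ys ⊕ zs) k) (+-congˡ (coeff-⊕ ys zs k)) ⟨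
      coeff (xs ⊕ (ys ⊕ zs)) k                ∎
      where open import Relation.Binary.Reasoning.Setoid setoid

    ⊕-comm : ∀ xs ys → xs ⊕ ys ≋ ys ⊕ xs
    ⊕-comm xs ys = coeff-ext λ k → trans (coeff-⊕ xs ys k) (trans (+-comm _ _) (sym (coeff-⊕ ys xs k)))

    ⊕-identityʳ : ∀ xs → xs ⊕ [] ≋ xs
    ⊕-identityʳ xs = coeff-ext λ k → trans (coeff-⊕ xs [] k) (+-identityʳ _)

    ⊕-isCommutativeMonoid : IsCommutativeMonoid _≋_ _⊕_ []
    ⊕-isCommutativeMonoid = record
      { isMonoid = record
        { isSemigroup = record
          { isMagma = record { isEquivalence = ≋-isEquivalence ; ∙-cong = ⊕-cong }
          ; assoc   = ⊕-assoc
          }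
        ; identity    = (λ _ → ≋-refl) , ⊕-identityʳ
        }
      ; comm = ⊕-comm
      }

    ⊕-commutativeMonoid : CommutativeMonoid a ℓ
    ⊕-commutativeMonoid = record { isCommutativeMonoid = ⊕-isCommutativeMonoid }

    open CommutativeSemigroupProperties (CommutativeMonoid.commutativeSemigroup ⊕-commutativeMonoid)
      using () renaming (interchange to ⊕-interchange; x∙yz≈y∙xz to ⊕-leftComm)

    shift-cong : ∀ {xs ys} → xs ≋ ys → shift xs ≋ shift ys
    shift-cong p = refl , p

    ⊕-shift : ∀ xs ys → shift (xs ⊕ ys) ≋ shift xs ⊕ shift ys
    ⊕-shift xs ys = sym (+-identityʳ 0#) , ≋-refl {xs ⊕ ys}

    ·-congˡ : ∀ {a b} xs → a ≈ b → a · xs ≋ b · xs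
    ·-congˡ {a} {b} xs a≈b = coeff-ext λ k → trans (coeff-· a xs k) (trans (*-congʳ a≈b) (sym (coeff-· b xs k)))

    ·-congʳ : ∀ a {xs ys} → xs ≋ ys → a · xs ≋ a · ys
    ·-congʳ a {xs} {ys} p = coeff-ext λ k →
      trans (coeff-· a xs k) (trans (*-congˡ (coeff-cong p k)) (sym (coeff-· a ys k)))

    ·-distrib-⊕ : ∀ a xs ys → a · (xs ⊕ ys) ≋ a · xs ⊕ a · ys
    ·-distrib-⊕ a xs ys = coeff-ext λ k → begin
      coeff (a · (xs ⊕ ys)) k            ≈⟨ trans (coeff-· a (xs ⊕ ys) k) (*-congˡ (coeff-⊕ xs ys k)) ⟩
      a * (coeff xs k + coeff ys k)      ≈⟨ distribˡ a _ _ ⟩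
      a * coeff xs k + a * coeff ys k    ≈⟨ trans (coeff-⊕ (a · xs) (a · ys) k)
                                                  (+-cong (coeff-· a xs k) (coeff-· a ys k)) ⟨
      coeff (a · xs ⊕ a · ys) k          ∎
      where open import Relation.Binary.Reasoning.Setoid setoid

    ·-distrib-+ : ∀ a b xs → (a + b) · xs ≋ a · xs ⊕ b · xs
    ·-distrib-+ a b xs = coeff-ext λ k → begin
      coeff ((a + b) · xs) k             ≈⟨ trans (coeff-· (a + b) xs k) (distribʳ _ a b) ⟩
      a * coeff xs k + b * coeff xs k    ≈⟨ trans (coeff-⊕ (a · xs) (b · xs) k)
                                                  (+-cong (coeff-· a xs k) (coeff-· b xs k)) ⟨
      coeff (a · xs ⊕ b · xs) k          ∎
      where open import Relation.Binary.Reasoning.Setoid setoid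

    ·-assoc : ∀ a b xs → (a * b) · xs ≋ a · (b · xs)
    ·-assoc a b xs = coeff-ext λ k →
      trans (coeff-· (a * b) xs k)
            (trans (*-assoc a b _) (sym (trans (coeff-· a (b · xs) k) (*-congˡ (coeff-· b xs k)))))

    0·xs≋[] : ∀ xs → 0# · xs ≋ []
    0·xs≋[] xs = coeff-ext λ k → trans (coeff-· 0# xs k) (zeroˡ _)

    1·xs≋xs : ∀ xs → 1# · xs ≋ xs
    1·xs≋xs xs = coeff-ext λ k → trans (coeff-· 1# xs k) (*-identityˡ _)

    ·-shift : ∀ a xs → a · shift xs ≋ shift (a · xs)
    ·-shift a xs = zeroʳ a , ≋-refl {a · xs}

    coeff-applyUpTo : ∀ g {L j} → j ℕ.< L → coeff (applyUpTo g L) j ≡ g j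
    coeff-applyUpTo g {suc L} {zero}  _         = ≡.refl
    coeff-applyUpTo g {suc L} {suc j} (s≤s j<L) = coeff-applyUpTo (g ∘ suc) j<L

    coeff-≥length : ∀ xs {k} → length xs ℕ.≤ k → coeff xs k ≡ 0#
    coeff-≥length []       _         = ≡.refl
    coeff-≥length (x ∷ xs) (s≤s len≤k) = coeff-≥length xs len≤k

    coeff-padding-< : ∀ {k i} xs → i ℕ.< k → coeff (replicate k 0# ++ xs) i ≡ 0#
    coeff-padding-< {suc k} {zero}  xs _         = ≡.refl
    coeff-padding-< {suc k} {suc i} xs (s≤s i<k) = coeff-padding-< xs i<k

    coeff-padding-+ : ∀ k xs i → coeff (replicate k 0# ++ xs) (k ℕ.+ i) ≡ coeff xs i
    coeff-padding-+ zero    xs i = ≡.refl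
    coeff-padding-+ (suc k) xs i = coeff-padding-+ k xs i

    open import Relation.Binary.Reasoning.Setoid ≋-setoid

    shift[]≋[] : shift [] ≋ []
    shift[]≋[] = refl , tt

    ⊗-zeroʳ : ∀ xs → xs ⊗ [] ≋ []
    ⊗-zeroʳ []       = tt
    ⊗-zeroʳ (x ∷ xs) = refl , ⊗-zeroʳ xs

    ≋[]⇒⊗≋[] : ∀ {xs} ys → xs ≋ [] → xs ⊗ ys ≋ []
    ≋[]⇒⊗≋[] {[]}     ys _                = tt
    ≋[]⇒⊗≋[] {x ∷ xs} ys (x≈0 , xs≋[]) = begin
      x · ys ⊕ shift (xs ⊗ ys)  ≈⟨ ⊕-cong (·-congˡ ys x≈0) (shift-cong (≋[]⇒⊗≋[] ys xs≋[])) ⟩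
      0# · ys ⊕ shift []        ≈⟨ ⊕-cong (0·xs≋[] ys) shift[]≋[] ⟩
      []                        ∎

    ⊗-congˡ : ∀ {xs xs′} ys → xs ≋ xs′ → xs ⊗ ys ≋ xs′ ⊗ ys
    ⊗-congˡ {[]}     {[]}       ys _         = tt
    ⊗-congˡ {[]}     {x′ ∷ xs′} ys p         = ≋-sym (≋[]⇒⊗≋[] ys (≋-sym {[]} {x′ ∷ xs′} p))
    ⊗-congˡ {x ∷ xs} {[]}       ys p         = ≋[]⇒⊗≋[] ys p
    ⊗-congˡ {x ∷ xs} {x′ ∷ xs′} ys (e , p)   = ⊕-cong (·-congˡ ys e) (shift-cong (⊗-congˡ ys p))

    ⊗-congʳ : ∀ xs {ys ys′} → ys ≋ ys′ → xs ⊗ ys ≋ xs ⊗ ys′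
    ⊗-congʳ []       p = tt
    ⊗-congʳ (x ∷ xs) p = ⊕-cong (·-congʳ x p) (shift-cong (⊗-congʳ xs p))

    ⊗-cong : ∀ {xs xs′ ys ys′} → xs ≋ xs′ → ys ≋ ys′ → xs ⊗ ys ≋ xs′ ⊗ ys′
    ⊗-cong {xs′ = xs′} {ys} p q = ≋-trans (⊗-congˡ ys p) (⊗-congʳ xs′ q)

    ⊗-distribʳ : ∀ xs ys zs → (ys ⊕ zs) ⊗ xs ≋ ys ⊗ xs ⊕ zs ⊗ xs
    ⊗-distribʳ xs []       zs       = ≋-refl
    ⊗-distribʳ xs (y ∷ ys) []       = ≋-sym (⊕-identityʳ _)
    ⊗-distribʳ xs (y ∷ ys) (z ∷ zs) = begin
      (y + z) · xs ⊕ shift ((ys ⊕ zs) ⊗ xs)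
        ≈⟨ ⊕-cong (·-distrib-+ y z xs) (shift-cong (⊗-distribʳ xs ys zs)) ⟩
      (y · xs ⊕ z · xs) ⊕ shift (ys ⊗ xs ⊕ zs ⊗ xs)
        ≈⟨ ⊕-cong {y · xs ⊕ z · xs} ≋-refl (⊕-shift (ys ⊗ xs) (zs ⊗ xs)) ⟩
      (y · xs ⊕ z · xs) ⊕ (shift (ys ⊗ xs) ⊕ shift (zs ⊗ xs))
        ≈⟨ ⊕-interchange (y · xs) (z · xs) _ _ ⟩
      (y · xs ⊕ shift (ys ⊗ xs)) ⊕ (z · xs ⊕ shift (zs ⊗ xs)) ∎

    [-]-⊗ : ∀ a xs → (a ∷ []) ⊗ xs ≋ a · xs
    [-]-⊗ a xs = ≋-trans (⊕-cong (≋-refl {a · xs}) shift[]≋[]) (⊕-identityʳ (a · xs))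

    ⊗-identityˡ : ∀ xs → (1# ∷ []) ⊗ xs ≋ xs
    ⊗-identityˡ xs = ≋-trans ([-]-⊗ 1# xs) (1·xs≋xs xs)

    ⊗-consʳ : ∀ xs y ys → xs ⊗ (y ∷ ys) ≋ y · xs ⊕ shift (xs ⊗ ys)
    ⊗-consʳ []       y ys = shift[]≋[]
    ⊗-consʳ (x ∷ xs) y ys = begin
      x · (y ∷ ys) ⊕ shift (xs ⊗ (y ∷ ys))
        ≈⟨ ⊕-cong {x · (y ∷ ys)} {x · (y ∷ ys)} {shift (xs ⊗ (y ∷ ys))} {shift (y · xs ⊕ shift (xs ⊗ ys))}
                  (≋-refl {x · (y ∷ ys)}) (shift-cong (⊗-consʳ xs y ys)) ⟩
      x · (y ∷ ys) ⊕ shift (y · xs ⊕ shift (xs ⊗ ys))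
        ≈⟨ +-congʳ (*-comm x y) , ⊕-leftComm (x · ys) (y · xs) _ ⟩
      y · (x ∷ xs) ⊕ shift ((x ∷ xs) ⊗ ys)
        ∎

    ⊗-comm : ∀ xs ys → xs ⊗ ys ≋ ys ⊗ xs
    ⊗-comm []       ys = ≋-sym (⊗-zeroʳ ys)
    ⊗-comm (x ∷ xs) ys = begin
      x · ys ⊕ shift (xs ⊗ ys)  ≈⟨ ⊕-cong (≋-refl {x · ys}) (shift-cong (⊗-comm xs ys)) ⟩
      x · ys ⊕ shift (ys ⊗ xs)  ≈⟨ ⊗-consʳ ys x xs ⟨
      ys ⊗ (x ∷ xs)             ∎

    ·-⊗ : ∀ a xs ys → (a · xs) ⊗ ys ≋ a · (xs ⊗ ys)
    ·-⊗ a []       ys = tt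
    ·-⊗ a (x ∷ xs) ys = begin
      (a * x) · ys ⊕ shift ((a · xs) ⊗ ys)  ≈⟨ ⊕-cong (·-assoc a x ys) (shift-cong (·-⊗ a xs ys)) ⟩
      a · (x · ys) ⊕ shift (a · (xs ⊗ ys))  ≈⟨ ⊕-cong (≋-refl {a · (x · ys)}) (·-shift a (xs ⊗ ys)) ⟨
      a · (x · ys) ⊕ a · shift (xs ⊗ ys)    ≈⟨ ·-distrib-⊕ a (x · ys) _ ⟨
      a · (x · ys ⊕ shift (xs ⊗ ys))        ∎

    shift-⊗ : ∀ xs ys → shift xs ⊗ ys ≋ shift (xs ⊗ ys)
    shift-⊗ xs ys = ⊕-cong (0·xs≋[] ys) (≋-refl {shift (xs ⊗ ys)})

    ⊗-assoc : ∀ xs ys zs → (xs ⊗ ys) ⊗ zs ≋ xs ⊗ (ys ⊗ zs)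
    ⊗-assoc []       ys zs = tt
    ⊗-assoc (x ∷ xs) ys zs = begin
      (x · ys ⊕ shift (xs ⊗ ys)) ⊗ zs        ≈⟨ ⊗-distribʳ zs (x · ys) (shift (xs ⊗ ys)) ⟩
      (x · ys) ⊗ zs ⊕ shift (xs ⊗ ys) ⊗ zs
        ≈⟨ ⊕-cong (·-⊗ x ys zs) (≋-trans (shift-⊗ (xs ⊗ ys) zs) (shift-cong (⊗-assoc xs ys zs))) ⟩
      x · (ys ⊗ zs) ⊕ shift (xs ⊗ (ys ⊗ zs)) ∎

    ⊕-⊗-isCommutativeSemiring : IsCommutativeSemiring _≋_ _⊕_ _⊗_ [] (1# ∷ [])
    ⊕-⊗-isCommutativeSemiring = isCommutativeSemiringˡ record
      { +-isCommutativeMonoid = ⊕-isCommutativeMonoid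
      ; *-isCommutativeMonoid = record
        { isMonoid = record
          { isSemigroup = record
            { isMagma = record { isEquivalence = ≋-isEquivalence ; ∙-cong = ⊗-cong }
            ; assoc   = ⊗-assoc
            }
          ; identity    = ⊗-identityˡ , λ xs → ≋-trans (⊗-comm xs (1# ∷ [])) (⊗-identityˡ xs)
          }
        ; comm = ⊗-comm
        }
      ; distribʳ = ⊗-distribʳ
      ; zeroˡ    = λ _ → tt
      }

  poly-isCommutativeSemiring : ∀ n → IsCommutativeSemiring (eqP n) (addP n) (mulP n) (zeroP n) (oneP n)

  poly-commutativeSemiring : ℕ → CommutativeSemiring c ℓr
  poly-commutativeSemiring n = record { isCommutativeSemiring = poly-isCommutativeSemiring n }

  poly-isCommutativeSemiring zero    = CommutativeRing.isCommutativeSemiring R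
  poly-isCommutativeSemiring (suc n) = CoefficientList.⊕-⊗-isCommutativeSemiring (poly-commutativeSemiring n)

  module S (n : ℕ) where
    open CommutativeSemiring (poly-commutativeSemiring n) public
    open import Algebra.Properties.CommutativeSemiring.Exp (poly-commutativeSemiring n) public
      using (_^_; ^-congˡ; ^-assocʳ; ^-distrib-*)
    open import Algebra.Properties.Semiring.Mult semiring public using (_×_)

  private module R = CommutativeRing R

  constP-cong : ∀ n {a b} → a R.≈ b → eqP n (constP n a) (constP n b)
  constP-cong zero    a≈b = a≈b
  constP-cong (suc n) a≈b = constP-cong n a≈b , tt

  constP-0# : ∀ n → eqP n (constP n R.0#) (zeroP n)
  constP-0# zero    = R.refl
  constP-0# (suc n) = constP-0# n , tt

  constP-+ : ∀ n a b → eqP n (constP n (a R.+ b)) (addP n (constP n a) (constP n b))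
  constP-+ zero    a b = R.refl
  constP-+ (suc n) a b = constP-+ n a b , tt

  constP-* : ∀ n a b → eqP n (constP n (a R.* b)) (mulP n (constP n a) (constP n b))
  constP-* zero    a b = R.refl
  constP-* (suc n) a b = S.trans n (constP-* n a b) (S.sym n (S.+-identityʳ n _)) , tt

  powP≈^ : ∀ n f k → eqP n (powP n f k) (S._^_ n f k)
  powP≈^ n f zero    = S.refl n
  powP≈^ n f (suc k) = S.*-congˡ n (powP≈^ n f k)

  powP-cong : ∀ n k {f g} → eqP n f g → eqP n (powP n f k) (powP n g k)
  powP-cong n k {f} {g} f≈g = S.trans n (powP≈^ n f k) (S.trans n (S.^-congˡ n k f≈g) (S.sym n (powP≈^ n g k)))

  powP-distrib-mulP : ∀ n f g k → eqP n (powP n (mulP n f g) k) (mulP n (powP n f k) (powP n g k))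
  powP-distrib-mulP n f g k = S.trans n (powP≈^ n _ k)
    (S.trans n (S.^-distrib-* n f g k) (S.sym n (S.*-cong n (powP≈^ n f k) (powP≈^ n g k))))

  powP-assoc : ∀ n f i j → eqP n (powP n (powP n f i) j) (powP n f (i ℕ.* j))
  powP-assoc n f i j = S.trans n (powP≈^ n _ j) (S.trans n (S.^-congˡ n j (powP≈^ n f i))
    (S.trans n (S.^-assocʳ n f i j) (S.sym n (powP≈^ n f (i ℕ.* j)))))

  powP-constP : ∀ n a k → eqP n (powP n (constP n a) k) (constP n (powP zero a k))
  powP-constP n a zero    = S.refl n
  powP-constP n a (suc k) = S.trans n (S.*-congˡ n (powP-constP n a k)) (S.sym n (constP-* n a _))

  powP-[-] : ∀ n f k → eqP (suc n) (powP (suc n) (f ∷ []) k) (powP n f k ∷ [])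
  powP-[-] n f zero    = S.refl n , tt
  powP-[-] n f (suc k) = S.trans (suc n) (S.*-congˡ (suc n) {f ∷ []} (powP-[-] n f k)) (S.+-identityʳ n _ , tt)

  module S[t] (n : ℕ) = CoefficientList (poly-commutativeSemiring n)

  var₀-* : ∀ n g → eqP (suc n) (mulP (suc n) (var (suc n) Fin.zero) g) (zeroP n ∷ g)
  var₀-* n g = S[t].⊕-cong n (S[t].0·xs≋[] n g) (S[t].shift-cong n (S[t].⊗-identityˡ n g))

  var₀^k-* : ∀ n k f →
             eqP (suc n) (mulP (suc n) (powP (suc n) (var (suc n) Fin.zero) k) f) (replicate k (zeroP n) ++ f)
  var₀^k-* n zero    f = S[t].⊗-identityˡ n f
  var₀^k-* n (suc k) f = S.trans (suc n) (S.*-assoc (suc n) x (powP (suc n) x k) f)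
    (S.trans (suc n) (var₀-* n _) (S[t].shift-cong n (var₀^k-* n k f)))
    where
    x : Poly (suc n)
    x = var (suc n) Fin.zero

  open import Algebra.Properties.Semiring.Mult R.semiring using () renaming (_×_ to _×ᴿ_)

  ×-oneP : ∀ n k → eqP n (S._×_ n k (oneP n)) (constP n (k ×ᴿ R.1#))
  ×-oneP n zero    = S.sym n (constP-0# n)
  ×-oneP n (suc k) = S.trans n (S.+-congˡ n (×-oneP n k)) (S.sym n (constP-+ n R.1# _))

  powP-q-distrib-addP : ∀ {p q d} → Prime p → p ×ᴿ R.1# R.≈ R.0# → q ≡ p ℕ.^ d →
                        ∀ n f g → eqP n (powP n (addP n f g) q) (addP n (powP n f q) (powP n g q))
  powP-q-distrib-addP {p} {d = d} p-prime char ≡.refl n f g =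
    S.trans n (powP≈^ n _ (p ℕ.^ d)) (S.trans n (^[p^d]-distrib-+ p-prime charₙ d f g)
      (S.sym n (S.+-cong n (powP≈^ n f (p ℕ.^ d)) (powP≈^ n g (p ℕ.^ d)))))
    where
    open PrimeCharacteristic (poly-commutativeSemiring n) using (^[p^d]-distrib-+)
    charₙ : eqP n (S._×_ n p (oneP n)) (zeroP n)
    charₙ = S.trans n (×-oneP n p) (S.trans n (constP-cong n char) (constP-0# n))

  sumP-cong : ∀ n k {f g : Fin k → Poly n} → (∀ i → eqP n (f i) (g i)) → eqP n (sumP n k f) (sumP n k g)
  sumP-cong n zero    f≈g = S.refl n
  sumP-cong n (suc k) f≈g = S.+-cong n (f≈g zero) (sumP-cong n k (f≈g ∘ suc))

  sumP-homomorphic : ∀ n (T : Poly n → Poly n) → eqP n (T (zeroP n)) (zeroP n) →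
                     (∀ f g → eqP n (T (addP n f g)) (addP n (T f) (T g))) →
                     ∀ k f → eqP n (T (sumP n k f)) (sumP n k (T ∘ f))
  sumP-homomorphic n T T-0 T-+ zero    f = T-0
  sumP-homomorphic n T T-0 T-+ (suc k) f =
    S.trans n (T-+ _ _) (S.+-congˡ n (sumP-homomorphic n T T-0 T-+ k (f ∘ suc)))

  module FrobeniusBasis
    (q′ : ℕ)
    (fermat : ∀ a → powP zero a (suc q′) R.≈ a)
    (frobenius-addP : ∀ n f g →
                      eqP n (powP n (addP n f g) (suc q′)) (addP n (powP n f (suc q′)) (powP n g (suc q′))))
    where

    q : ℕ
    q = suc q′

    infixl 6 _*q+_
    _*q+_ : ℕ → Fin q → ℕ
    j *q+ r = j ℕ.* q ℕ.+ toℕ r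

    φ : ∀ n → Poly n → Poly n
    φ n f = powP n f q

    Exponent : ℕ → Set
    Exponent = Vec (Fin q)

    0ₑ : ∀ {n} → Exponent n
    0ₑ = Vec.replicate _ zero

    -- f = Σ_e x^e φ(π n e f), the decomposition of S_n as a free φ(S_n)-module.
    π : ∀ n → Exponent n → Poly n → Poly n
    π zero    []      f = f
    π (suc n) (r ∷ e) f = applyUpTo (λ j → π n e (S[t].coeff n f (j *q+ r))) (length f)

    π-zeroP : ∀ n e → π n e (zeroP n) ≡ zeroP n
    π-zeroP zero    []      = ≡.refl
    π-zeroP (suc n) (r ∷ e) = ≡.refl

    coeff-π : ∀ n r e f j → S[t].coeff n (π (suc n) (r ∷ e) f) j ≡ π n e (S[t].coeff n f (j *q+ r))
    coeff-π n r e f j with j ℕ.<? length f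
    ... | yes j<len = S[t].coeff-applyUpTo n _ j<len
    ... | no  j≮len = begin
      S[t].coeff n (π (suc n) (r ∷ e) f) j         ≡⟨ S[t].coeff-≥length n (π (suc n) (r ∷ e) f) len-πf≤j ⟩
      zeroP n                                      ≡⟨ π-zeroP n e ⟨
      π n e (zeroP n)                              ≡⟨ ≡.cong (π n e) (S[t].coeff-≥length n f len-f≤j*q+r) ⟨
      π n e (S[t].coeff n f (j *q+ r))             ∎
      where
      open ≡.≡-Reasoning
      len-f≤j : length f ≤ j
      len-f≤j = ℕ.≮⇒≥ j≮len
      len-πf≤j : length (π (suc n) (r ∷ e) f) ≤ j
      len-πf≤j = ℕ.≤-trans (ℕ.≤-reflexive (length-applyUpTo _ (length f))) len-f≤j
      len-f≤j*q+r : length f ≤ j *q+ r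
      len-f≤j*q+r = ℕ.≤-trans len-f≤j (ℕ.≤-trans (ℕ.m≤m*n j q) (ℕ.m≤m+n _ _))

    quot-rem : ∀ k → Σ ℕ λ j → Σ (Fin q) λ r → k ≡ j *q+ r
    quot-rem k with k divMod q
    ... | result j r k≡r+j*q = j , r , ≡.trans k≡r+j*q (ℕ.+-comm (toℕ r) (j ℕ.* q))

    [j*q+r]/q≡j : ∀ j (r : Fin q) → (j *q+ r) / q ≡ j
    [j*q+r]/q≡j j r = begin
      (j *q+ r) / q              ≡⟨ +-distrib-/-∣ˡ (toℕ r) (n∣m*n j) ⟩
      j ℕ.* q / q ℕ.+ toℕ r / q  ≡⟨ ≡.cong₂ ℕ._+_ (m*n/n≡m j q) (m<n⇒m/n≡0 (toℕ<n r)) ⟩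
      j ℕ.+ 0                    ≡⟨ ℕ.+-identityʳ j ⟩
      j                          ∎
      where open ≡.≡-Reasoning

    [j*q+r]modq≡r : ∀ j (r : Fin q) → (j *q+ r) mod q ≡ r
    [j*q+r]modq≡r j r = toℕ-injective (begin
      toℕ ((j *q+ r) mod q)    ≡⟨ toℕ-fromℕ< _ ⟩
      (j *q+ r) % q            ≡⟨ ≡.cong (_% q) (ℕ.+-comm (j ℕ.* q) (toℕ r)) ⟩
      (toℕ r ℕ.+ j ℕ.* q) % q  ≡⟨ [m+kn]%n≡m%n (toℕ r) j q ⟩
      toℕ r % q                ≡⟨ m<n⇒m%n≡m (toℕ<n r) ⟩
      toℕ r                    ∎)
      where open ≡.≡-Reasoning

    j*q+r<B*q : ∀ {j B} (r : Fin q) → j < B → j *q+ r < B ℕ.* q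
    j*q+r<B*q {j} {B} r j<B = begin-strict
      j *q+ r         <⟨ ℕ.+-monoʳ-< (j ℕ.* q) (toℕ<n r) ⟩
      j ℕ.* q ℕ.+ q   ≡⟨ ℕ.+-comm (j ℕ.* q) q ⟩
      suc j ℕ.* q     ≤⟨ ℕ.*-monoˡ-≤ q j<B ⟩
      B ℕ.* q         ∎
      where open ℕ.≤-Reasoning

    B*q≤j*q+r : ∀ {j B} (r : Fin q) → B ≤ j → B ℕ.* q ≤ j *q+ r
    B*q≤j*q+r {j} r B≤j = ℕ.≤-trans (ℕ.*-monoˡ-≤ q B≤j) (ℕ.m≤m+n (j ℕ.* q) (toℕ r))

    record CoordinateLaws (n : ℕ) : Set (c ⊔ ℓr) where
      field
        π-cong       : ∀ e {f g} → eqP n f g → eqP n (π n e f) (π n e g)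
        π-addP       : ∀ e f g → eqP n (π n e (addP n f g)) (addP n (π n e f) (π n e g))
        π-φ-mulP     : ∀ e h f → eqP n (π n e (mulP n (φ n h) f)) (mulP n h (π n e f))
        π-injective  : ∀ f g → (∀ e → eqP n (π n e f) (π n e g)) → eqP n f g
        π-surjective : ∀ (G : Exponent n → Poly n) → Σ (Poly n) λ f → ∀ e → eqP n (π n e f) (G e)
        π₀-oneP      : eqP n (π n 0ₑ (oneP n)) (oneP n)

    module CoordinateLawsStep (n : ℕ) (laws : CoordinateLaws n) where
      open CoordinateLaws laws
      private
        module Sₙ = S n
        module S₊ = S (suc n)
      open S[t] n using (coeff; coeff-ext; coeff-cong; coeff-⊕; coeff-·; coeff-applyUpTo; coeff-≥length)
      open S[t] n using (coeff-padding-<; coeff-padding-+; _⊕_; _·_; [-]-⊗; ≋-refl)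

      π₊ : Exponent (suc n) → Poly (suc n) → Poly (suc n)
      π₊ = π (suc n)

      π₊-coeffwise : ∀ r e f g → (∀ j → eqP n (π n e (coeff f (j *q+ r))) (coeff g j)) →
                     eqP (suc n) (π₊ (r ∷ e) f) g
      π₊-coeffwise r e f g h = coeff-ext λ j → Sₙ.trans (Sₙ.reflexive (coeff-π n r e f j)) (h j)

      π₊-cong : ∀ e {f g} → eqP (suc n) f g → eqP (suc n) (π₊ e f) (π₊ e g)
      π₊-cong (r ∷ e) {f} {g} f≈g = π₊-coeffwise r e f (π₊ (r ∷ e) g) λ j →
        Sₙ.trans (π-cong e (coeff-cong f≈g _)) (Sₙ.reflexive (≡.sym (coeff-π n r e g j)))

      π₊-addP : ∀ e f g → eqP (suc n) (π₊ e (f ⊕ g)) (π₊ e f ⊕ π₊ e g)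
      π₊-addP (r ∷ e) f g = π₊-coeffwise r e (f ⊕ g) (π₊ (r ∷ e) f ⊕ π₊ (r ∷ e) g) coeffs
        where
        open import Relation.Binary.Reasoning.Setoid Sₙ.setoid
        coeffs : ∀ j → eqP n (π n e (coeff (f ⊕ g) (j *q+ r))) (coeff (π₊ (r ∷ e) f ⊕ π₊ (r ∷ e) g) j)
        coeffs j = begin
          π n e (coeff (f ⊕ g) (j *q+ r))                           ≈⟨ π-cong e (coeff-⊕ f g _) ⟩
          π n e (coeff f (j *q+ r) Sₙ.+ coeff g (j *q+ r))          ≈⟨ π-addP e _ _ ⟩
          π n e (coeff f (j *q+ r)) Sₙ.+ π n e (coeff g (j *q+ r))  ≡⟨ ≡.cong₂ Sₙ._+_ (coeff-π n r e f j)
                                                                                      (coeff-π n r e g j) ⟨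
          coeff (π₊ (r ∷ e) f) j Sₙ.+ coeff (π₊ (r ∷ e) g) j        ≈⟨ coeff-⊕ (π₊ (r ∷ e) f) _ j ⟨
          coeff (π₊ (r ∷ e) f ⊕ π₊ (r ∷ e) g) j                     ∎

      π₊-injective : ∀ f g → (∀ e → eqP (suc n) (π₊ e f) (π₊ e g)) → eqP (suc n) f g
      π₊-injective f g πf≈πg = coeff-ext λ k → coeffs k (quot-rem k)
        where
        open import Relation.Binary.Reasoning.Setoid Sₙ.setoid
        coeffs : ∀ k → (Σ ℕ λ j → Σ (Fin q) λ r → k ≡ j *q+ r) → eqP n (coeff f k) (coeff g k)
        coeffs _ (j , r , ≡.refl) = π-injective _ _ λ e → begin
          π n e (coeff f (j *q+ r))  ≡⟨ coeff-π n r e f j ⟨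
          coeff (π₊ (r ∷ e) f) j     ≈⟨ coeff-cong (πf≈πg (r ∷ e)) j ⟩
          coeff (π₊ (r ∷ e) g) j     ≡⟨ coeff-π n r e g j ⟩
          π n e (coeff g (j *q+ r))  ∎

      π₊-surjective : ∀ G → Σ (Poly (suc n)) λ f → ∀ e → eqP (suc n) (π₊ e f) (G e)
      π₊-surjective G = f , λ where (r ∷ e) → π₊-coeffwise r e f (G (r ∷ e)) (coeffs r e)
        where
        open import Relation.Binary.Reasoning.Setoid Sₙ.setoid
        B : ℕ
        B = proj₁ (bounded-Vec (suc n) (length ∘ G))
        preimage : Fin q → ℕ → Poly n
        preimage r j = proj₁ (π-surjective λ e → coeff (G (r ∷ e)) j)
        f : Poly (suc n)
        f = applyUpTo (λ k → preimage (k mod q) (k / q)) (B ℕ.* q)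
        coeffs : ∀ r e j → eqP n (π n e (coeff f (j *q+ r))) (coeff (G (r ∷ e)) j)
        coeffs r e j with j ℕ.<? B
        ... | yes j<B = begin
          π n e (coeff f (j *q+ r))                           ≡⟨ ≡.cong (π n e) (coeff-applyUpTo _ (j*q+r<B*q r j<B)) ⟩
          π n e (preimage ((j *q+ r) mod q) ((j *q+ r) / q))  ≡⟨ ≡.cong₂ (λ r j → π n e (preimage r j))
                                                                        ([j*q+r]modq≡r j r) ([j*q+r]/q≡j j r) ⟩
          π n e (preimage r j)                                ≈⟨ proj₂ (π-surjective _) e ⟩
          coeff (G (r ∷ e)) j                                 ∎
        ... | no j≮B = begin
          π n e (coeff f (j *q+ r))  ≡⟨ ≡.cong (π n e) (coeff-≥length f len-f≤) ⟩
          π n e (zeroP n)            ≡⟨ π-zeroP n e ⟩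
          zeroP n                    ≡⟨ coeff-≥length (G (r ∷ e)) len-G≤ ⟨
          coeff (G (r ∷ e)) j        ∎
          where
          len-f≤ : length f ≤ j *q+ r
          len-f≤ = ℕ.≤-trans (ℕ.≤-reflexive (length-applyUpTo _ (B ℕ.* q))) (B*q≤j*q+r r (ℕ.≮⇒≥ j≮B))
          len-G≤ : length (G (r ∷ e)) ≤ j
          len-G≤ = ℕ.≤-trans (proj₂ (bounded-Vec (suc n) (length ∘ G)) (r ∷ e)) (ℕ.≮⇒≥ j≮B)

      π₊₀-oneP : eqP (suc n) (π₊ 0ₑ (oneP (suc n))) (oneP (suc n))
      π₊₀-oneP = π₀-oneP , tt

      Semilinear : Poly (suc n) → Set (c ⊔ ℓr)
      Semilinear h = ∀ e f → eqP (suc n) (π₊ e (φ (suc n) h S₊.* f)) (h S₊.* π₊ e f)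

      module _ where
        open S₊ using (_+_; _*_)
        open import Relation.Binary.Reasoning.Setoid S₊.setoid

        semilinear-cong : ∀ {h h′} → eqP (suc n) h h′ → Semilinear h → Semilinear h′
        semilinear-cong {h} {h′} h≈h′ sl-h e f = begin
          π₊ e (φ (suc n) h′ * f)  ≈⟨ π₊-cong e (S₊.*-congʳ (powP-cong (suc n) q h≈h′)) ⟨
          π₊ e (φ (suc n) h * f)   ≈⟨ sl-h e f ⟩
          h * π₊ e f               ≈⟨ S₊.*-congʳ h≈h′ ⟩
          h′ * π₊ e f              ∎

        semilinear-+ : ∀ {h₁ h₂} → Semilinear h₁ → Semilinear h₂ → Semilinear (h₁ + h₂)
        semilinear-+ {h₁} {h₂} sl₁ sl₂ e f = begin
          π₊ e (φ₊ (h₁ + h₂) * f)               ≈⟨ π₊-cong e (S₊.*-congʳ (frobenius-addP (suc n) h₁ h₂)) ⟩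
          π₊ e ((φ₊ h₁ + φ₊ h₂) * f)            ≈⟨ π₊-cong e (S₊.distribʳ f (φ₊ h₁) (φ₊ h₂)) ⟩
          π₊ e (φ₊ h₁ * f + φ₊ h₂ * f)          ≈⟨ π₊-addP e _ _ ⟩
          π₊ e (φ₊ h₁ * f) + π₊ e (φ₊ h₂ * f)   ≈⟨ S₊.+-cong (sl₁ e f) (sl₂ e f) ⟩
          h₁ * π₊ e f + h₂ * π₊ e f             ≈⟨ S₊.distribʳ (π₊ e f) h₁ h₂ ⟨
          (h₁ + h₂) * π₊ e f                    ∎
          where
          φ₊ : Poly (suc n) → Poly (suc n)
          φ₊ = φ (suc n)

        semilinear-* : ∀ {h₁ h₂} → Semilinear h₁ → Semilinear h₂ → Semilinear (h₁ * h₂)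
        semilinear-* {h₁} {h₂} sl₁ sl₂ e f = begin
          π₊ e (φ₊ (h₁ * h₂) * f)        ≈⟨ π₊-cong e (S₊.*-congʳ (powP-distrib-mulP (suc n) h₁ h₂ q)) ⟩
          π₊ e (φ₊ h₁ * φ₊ h₂ * f)       ≈⟨ π₊-cong e (S₊.*-assoc (φ₊ h₁) (φ₊ h₂) f) ⟩
          π₊ e (φ₊ h₁ * (φ₊ h₂ * f))     ≈⟨ sl₁ e _ ⟩
          h₁ * π₊ e (φ₊ h₂ * f)          ≈⟨ S₊.*-congˡ {h₁} (sl₂ e f) ⟩
          h₁ * (h₂ * π₊ e f)             ≈⟨ S₊.*-assoc h₁ h₂ _ ⟨
          h₁ * h₂ * π₊ e f               ∎
          where
          φ₊ : Poly (suc n) → Poly (suc n)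
          φ₊ = φ (suc n)

        semilinear-[-] : ∀ a → Semilinear (a ∷ [])
        semilinear-[-] a (r ∷ e) f = begin
          π₊ (r ∷ e) (φ (suc n) (a ∷ []) * f)  ≈⟨ π₊-cong (r ∷ e) (S₊.*-congʳ (powP-[-] n a q)) ⟩
          π₊ (r ∷ e) ((φ n a ∷ []) * f)        ≈⟨ π₊-cong (r ∷ e) ([-]-⊗ (φ n a) f) ⟩
          π₊ (r ∷ e) (φ n a · f)               ≈⟨ π₊-coeffwise r e (φ n a · f) (a · π₊ (r ∷ e) f) coeffs ⟩
          a · π₊ (r ∷ e) f                     ≈⟨ [-]-⊗ a _ ⟨
          (a ∷ []) * π₊ (r ∷ e) f              ∎
          where
          coeffs : ∀ j → eqP n (π n e (coeff (φ n a · f) (j *q+ r))) (coeff (a · π₊ (r ∷ e) f) j)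
          coeffs j = Sₙ.trans (π-cong e (coeff-· (φ n a) f _)) (Sₙ.trans (π-φ-mulP e a _) (Sₙ.sym
                       (Sₙ.trans (coeff-· a (π₊ (r ∷ e) f) j) (Sₙ.*-congˡ (Sₙ.reflexive (coeff-π n r e f j))))))

        semilinear-var₀ : Semilinear (var (suc n) zero)
        semilinear-var₀ (r ∷ e) f = begin
          π₊ (r ∷ e) (φ (suc n) (var (suc n) zero) * f)  ≈⟨ π₊-cong (r ∷ e) (var₀^k-* n q f) ⟩
          π₊ (r ∷ e) padded                              ≈⟨ π₊-coeffwise r e padded (zeroP n ∷ _) coeffs ⟩
          zeroP n ∷ π₊ (r ∷ e) f                         ≈⟨ var₀-* n (π₊ (r ∷ e) f) ⟨
          var (suc n) zero * π₊ (r ∷ e) f                ∎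
          where
          padded : Poly (suc n)
          padded = replicate q (zeroP n) ++ f
          coeffs : ∀ j → eqP n (π n e (coeff padded (j *q+ r))) (coeff (zeroP n ∷ π₊ (r ∷ e) f) j)
          coeffs zero    = Sₙ.reflexive (≡.trans (≡.cong (π n e) (coeff-padding-< f (toℕ<n r))) (π-zeroP n e))
          coeffs (suc j) = Sₙ.reflexive (≡.trans
            (≡.cong (π n e ∘ coeff padded) (ℕ.+-assoc q (j ℕ.* q) (toℕ r)))
            (≡.trans (≡.cong (π n e) (coeff-padding-+ q f (j *q+ r))) (≡.sym (coeff-π n r e f j))))

        cons≈[-]+var₀* : ∀ a h → eqP (suc n) (a ∷ h) ((a ∷ []) + var (suc n) zero * h)
        cons≈[-]+var₀* a h = begin
          a ∷ h                              ≈⟨ Sₙ.+-identityʳ a , ≋-refl ⟨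
          (a ∷ []) + (zeroP n ∷ h)           ≈⟨ S₊.+-congˡ {a ∷ []} (var₀-* n h) ⟨
          (a ∷ []) + var (suc n) zero * h    ∎

        semilinear : ∀ h → Semilinear h
        semilinear []      (r ∷ e) f = tt
        semilinear (a ∷ h)           = semilinear-cong (S₊.sym (cons≈[-]+var₀* a h))
          (semilinear-+ {a ∷ []} {var (suc n) zero * h} (semilinear-[-] a)
            (semilinear-* {var (suc n) zero} {h} semilinear-var₀ (semilinear h)))

    coordinateLaws : ∀ n → CoordinateLaws n
    coordinateLaws zero = record
      { π-cong       = λ where [] f≈g → f≈g
      ; π-addP       = λ where [] f g → R.refl
      ; π-φ-mulP     = λ where [] h f → R.*-congʳ (fermat h)
      ; π-injective  = λ f g πf≈πg → πf≈πg []
      ; π-surjective = λ G → G [] , λ where [] → R.refl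
      ; π₀-oneP      = R.refl
      }
    coordinateLaws (suc n) = record
      { π-cong       = π₊-cong
      ; π-addP       = π₊-addP
      ; π-φ-mulP     = λ e h → semilinear h e
      ; π-injective  = π₊-injective
      ; π-surjective = π₊-surjective
      ; π₀-oneP      = π₊₀-oneP
      }
      where open CoordinateLawsStep n (coordinateLaws n)

    module _ (l : ℕ) where
      open CoordinateLaws (coordinateLaws l)
      private module Sₗ = S l
      open Sₗ using (_≈_; _+_; _*_)
      open import Relation.Binary.Reasoning.Setoid Sₗ.setoid

      φ-constP : ∀ a → φ l (constP l a) ≈ constP l a
      φ-constP a = Sₗ.trans (powP-constP l a q) (constP-cong l (fermat a))

      φ-sumP : ∀ k f → φ l (sumP l k f) ≈ sumP l k (φ l ∘ f)
      φ-sumP = sumP-homomorphic l (φ l) (Sₗ.zeroˡ _) (frobenius-addP l)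

      π-sumP : ∀ e k f → π l e (sumP l k f) ≈ sumP l k (π l e ∘ f)
      π-sumP e = sumP-homomorphic l (π l e) (Sₗ.reflexive (π-zeroP l e)) (π-addP e)

      π-constP-mulP : ∀ e a f → π l e (constP l a * f) ≈ constP l a * π l e f
      π-constP-mulP e a f = Sₗ.trans (π-cong e (Sₗ.*-congʳ (Sₗ.sym (φ-constP a)))) (π-φ-mulP e (constP l a) f)

      π-mulP-φ : ∀ e f h → π l e (f * φ l h) ≈ π l e f * h
      π-mulP-φ e f h = begin
        π l e (f * φ l h)  ≈⟨ π-cong e (Sₗ.*-comm f (φ l h)) ⟩
        π l e (φ l h * f)  ≈⟨ π-φ-mulP e h f ⟩
        h * π l e f        ≈⟨ Sₗ.*-comm h (π l e f) ⟩
        π l e f * h        ∎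

      π₀-φ : ∀ g → π l 0ₑ (φ l g) ≈ g
      π₀-φ g = begin
        π l 0ₑ (φ l g)             ≈⟨ π-cong 0ₑ (Sₗ.*-identityʳ (φ l g)) ⟨
        π l 0ₑ (φ l g * oneP l)    ≈⟨ π-φ-mulP 0ₑ g (oneP l) ⟩
        g * π l 0ₑ (oneP l)        ≈⟨ Sₗ.*-congˡ π₀-oneP ⟩
        g * oneP l                 ≈⟨ Sₗ.*-identityʳ g ⟩
        g                          ∎

      powP-q* : ∀ f k → powP l f (q ℕ.* k) ≈ φ l (powP l f k)
      powP-q* f k = Sₗ.sym (Sₗ.trans (powP-assoc l f k q) (Sₗ.reflexive (≡.cong (powP l f) (ℕ.*-comm k q))))

      applyLin-frobDer : ∀ (θ : Der l) α → applyLin (frobDer q θ) α ≈ φ l (applyLin θ α)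
      applyLin-frobDer θ α = Sₗ.sym (Sₗ.trans (φ-sumP l _) (sumP-cong l l λ i →
        Sₗ.trans (powP-distrib-mulP l (constP l (α i)) (θ i) q) (Sₗ.*-congʳ (φ-constP (α i)))))

      applyLin-π : ∀ e (η : Der l) α → applyLin (π l e ∘ η) α ≈ π l e (applyLin η α)
      applyLin-π e η α = Sₗ.sym (Sₗ.trans (π-sumP e l _) (sumP-cong l l λ i → π-constP-mulP e (α i) (η i)))

      combo-frobDer-π : ∀ e f (θ : Fin l → Der l) i →
                        π l e (combo f (frobDer q ∘ θ) i) ≈ combo (π l e ∘ f) θ i
      combo-frobDer-π e f θ i = Sₗ.trans (π-sumP e l _) (sumP-cong l l λ j → π-mulP-φ e (f j) (θ j i))

      φ-combo : ∀ f (θ : Fin l → Der l) i → φ l (combo f θ i) ≈ combo (φ l ∘ f) (frobDer q ∘ θ) i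
      φ-combo f θ i = Sₗ.trans (φ-sumP l _) (sumP-cong l l λ j → powP-distrib-mulP l (f j) (θ j i) q)

      module _ {k : ℕ} (α : Fin k → LinForm l) (μ : Multiplicity k) where

        InD-frobDer : ∀ {θ} → InD α μ θ → InD α (scaleMult q μ) (frobDer q θ)
        InD-frobDer {θ} θ∈D j = φ l h , (begin
          applyLin (frobDer q θ) (α j)                 ≈⟨ applyLin-frobDer θ (α j) ⟩
          φ l (applyLin θ (α j))                       ≈⟨ powP-cong l q (proj₂ (θ∈D j)) ⟩
          φ l (powP l (linP (α j)) (μ j) * h)          ≈⟨ powP-distrib-mulP l _ h q ⟩
          φ l (powP l (linP (α j)) (μ j)) * φ l h      ≈⟨ Sₗ.*-congʳ (powP-q* (linP (α j)) (μ j)) ⟨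
          powP l (linP (α j)) (q ℕ.* μ j) * φ l h      ∎)
          where
          h : Poly l
          h = proj₁ (θ∈D j)

        InD-π : ∀ e {η} → InD α (scaleMult q μ) η → InD α μ (π l e ∘ η)
        InD-π e {η} η∈D j = π l e h , (begin
          applyLin (π l e ∘ η) (α j)                    ≈⟨ applyLin-π e η (α j) ⟩
          π l e (applyLin η (α j))                      ≈⟨ π-cong e (proj₂ (η∈D j)) ⟩
          π l e (powP l (linP (α j)) (q ℕ.* μ j) * h)   ≈⟨ π-cong e (Sₗ.*-congʳ (powP-q* (linP (α j)) (μ j))) ⟩
          π l e (φ l (powP l (linP (α j)) (μ j)) * h)   ≈⟨ π-φ-mulP e _ h ⟩
          powP l (linP (α j)) (μ j) * π l e h           ∎)
          where
          h : Poly l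
          h = proj₁ (η∈D j)

        InD-frobDer⁻¹ : ∀ {θ} → InD α (scaleMult q μ) (frobDer q θ) → InD α μ θ
        InD-frobDer⁻¹ {θ} φθ∈D j =
          proj₁ π₀φθ∈D , Sₗ.trans (sumP-cong l l λ i → Sₗ.*-congˡ (Sₗ.sym (π₀-φ (θ i))))
                                  (proj₂ π₀φθ∈D)
          where
          π₀φθ∈D : InIdeal l (applyLin (π l 0ₑ ∘ frobDer q θ) (α j)) (powP l (linP (α j)) (μ j))
          π₀φθ∈D = InD-π 0ₑ φθ∈D j

        isBasis⇒frobDer-isBasis : ∀ {θ} → IsBasis α μ θ → IsBasis α (scaleMult q μ) (frobDer q ∘ θ)
        isBasis⇒frobDer-isBasis {θ} θ-basis = record
          { members     = InD-frobDer ∘ B.members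
          ; spanning    = spanning
          ; independent = independent
          }
          where
          module B = IsBasis θ-basis

          spanning : ∀ η → InD α (scaleMult q μ) η →
                     Σ (Fin l → Poly l) λ f → ∀ i → η i ≈ combo f (frobDer q ∘ θ) i
          spanning η η∈D = f , λ i → π-injective _ _ λ e → begin
            π l e (η i)                          ≈⟨ proj₂ (coords e) i ⟩
            combo (proj₁ (coords e)) θ i         ≈⟨ sumP-cong l l (λ j → Sₗ.*-congʳ (proj₂ (assemble j) e)) ⟨
            combo (π l e ∘ f) θ i                ≈⟨ combo-frobDer-π e f θ i ⟨
            π l e (combo f (frobDer q ∘ θ) i)    ∎
            where
            coords : ∀ e → Σ (Fin l → Poly l) λ g → ∀ i → π l e (η i) ≈ combo g θ i
            coords e = B.spanning (π l e ∘ η) (InD-π e η∈D)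
            assemble : ∀ j → Σ (Poly l) λ fⱼ → ∀ e → π l e fⱼ ≈ proj₁ (coords e) j
            assemble j = π-surjective λ e → proj₁ (coords e) j
            f : Fin l → Poly l
            f = proj₁ ∘ assemble

          independent : ∀ f → (∀ i → combo f (frobDer q ∘ θ) i ≈ zeroP l) → ∀ j → f j ≈ zeroP l
          independent f Σ≈0 j = π-injective _ _ λ e → begin
            π l e (f j)      ≈⟨ B.independent (π l e ∘ f) (πΣ≈0 e) j ⟩
            zeroP l          ≡⟨ π-zeroP l e ⟨
            π l e (zeroP l)  ∎
            where
            πΣ≈0 : ∀ e i → combo (π l e ∘ f) θ i ≈ zeroP l
            πΣ≈0 e i = begin
              combo (π l e ∘ f) θ i              ≈⟨ combo-frobDer-π e f θ i ⟨
              π l e (combo f (frobDer q ∘ θ) i)  ≈⟨ π-cong e (Σ≈0 i) ⟩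
              π l e (zeroP l)                    ≡⟨ π-zeroP l e ⟩
              zeroP l                            ∎

        frobDer-isBasis⇒isBasis : ∀ {θ} → IsBasis α (scaleMult q μ) (frobDer q ∘ θ) → IsBasis α μ θ
        frobDer-isBasis⇒isBasis {θ} φθ-basis = record
          { members     = InD-frobDer⁻¹ ∘ B.members
          ; spanning    = spanning
          ; independent = independent
          }
          where
          module B = IsBasis φθ-basis

          spanning : ∀ η → InD α μ η → Σ (Fin l → Poly l) λ f → ∀ i → η i ≈ combo f θ i
          spanning η η∈D = π l 0ₑ ∘ f , λ i → begin
            η i                                   ≈⟨ π₀-φ (η i) ⟨
            π l 0ₑ (φ l (η i))                    ≈⟨ π-cong 0ₑ (φη≈ i) ⟩
            π l 0ₑ (combo f (frobDer q ∘ θ) i)    ≈⟨ combo-frobDer-π 0ₑ f θ i ⟩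
            combo (π l 0ₑ ∘ f) θ i                ∎
            where
            f : Fin l → Poly l
            f = proj₁ (B.spanning (frobDer q η) (InD-frobDer η∈D))
            φη≈ : ∀ i → φ l (η i) ≈ combo f (frobDer q ∘ θ) i
            φη≈ = proj₂ (B.spanning (frobDer q η) (InD-frobDer η∈D))

          independent : ∀ f → (∀ i → combo f θ i ≈ zeroP l) → ∀ j → f j ≈ zeroP l
          independent f Σ≈0 j = begin
            f j                      ≈⟨ π₀-φ (f j) ⟨
            π l 0ₑ (φ l (f j))       ≈⟨ π-cong 0ₑ (B.independent (φ l ∘ f) φΣ≈0 j) ⟩
            π l 0ₑ (zeroP l)         ≡⟨ π-zeroP l 0ₑ ⟩
            zeroP l                  ∎
            where
            φΣ≈0 : ∀ i → combo (φ l ∘ f) (frobDer q ∘ θ) i ≈ zeroP l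
            φΣ≈0 i = Sₗ.trans (Sₗ.sym (φ-combo f θ i)) (Sₗ.trans (powP-cong l q (Σ≈0 i)) (Sₗ.zeroˡ _))

open import Data.Nat using (_^_)

theorem2p2 : ∀ {c ℓr : Level} (R : CommutativeRing c ℓr) (p d q : ℕ) →
    Prime p → q ≡ p ^ d →
    Over.IsField R → Over.HasCard R q →
    (l m : ℕ) (α : Fin m → Over.LinForm R l) → Over.IsArrangement R α →
    (μ : Over.Multiplicity R m) (θ : Fin l → Over.Der R l) →
    Over.IsBasis R α μ θ ⇔
    Over.IsBasis R α (Over.scaleMult R q μ) (λ j → Over.frobDer R q (θ j))
theorem2p2 R p d zero p-prime q≡p^d isField card l m α _ μ θ
  with () ← proj₁ (Over.HasCard.enum-surj card (CommutativeRing.0# R))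
theorem2p2 R p d (suc q′) p-prime q≡p^d isField card l m α _ μ θ =
  mk⇔ (isBasis⇒frobDer-isBasis l α μ) (frobDer-isBasis⇒isBasis l α μ)
  where
  open FiniteField R isField card using (x^q≈x; p×1≈0)
  open FrobeniusBasis R q′ x^q≈x (powP-q-distrib-addP R {d = d} p-prime (p×1≈0 {p} {d} q≡p^d) q≡p^d)
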